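{- Let $\mathcal{R}_1,\mathcal{R}_2,\mathcal{S}$ be TRSs and $t$ a term that is terminating with respect to $\to_{(\mathcal{R}_1\cup\mathcal{R}_2)/\mathcal{S}}$. Then \[ \mathrm{dl}(t,\to_{\mathcal{R}_1/(\mathcal{R}_2\cup\mathcal{S})})+\mathrm{dl}(t,\to_{\mathcal{R}_2/(\mathcal{R}_1\cup\mathcal{S})})\ge\mathrm{dl}(t,\to_{(\mathcal{R}_1\cup\mathcal{R}_2)/\mathcal{S}}). \]
   Context: $\to_{\mathcal{R}/\mathcal{S}}=\to_{\mathcal{S}}^*\cdot\to_{\mathcal{R}}\cdot\to_{\mathcal{S}}^*$. $\mathrm{dl}(t,\to)=\sup\{m\mid\exists u,\ t\to^mu\}$. A term is terminating w.r.t. $\to$ if it admits no infinite $\to$-sequence. -}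

module Defs where

open import Level using (Level; 0ℓ)
open import Data.Nat using (ℕ; zero; suc; _+_; _≤_)
open import Data.Fin using (Fin)
open import Data.Vec using (Vec; []; _∷_; lookup; _[_]≔_)
open import Data.Product using (Σ; _×_; _,_; ∃)
open import Data.Sum using (_⊎_)
open import Data.Empty using (⊥)
open import Relation.Nullary using (¬_)
open import Relation.Binary.PropositionalEquality using (_≡_)
open import Relation.Binary.Construct.Closure.ReflexiveTransitive using (Star)

record Signature : Set₁ where
  field
    Sym   : Set
    arity : Sym → ℕ

module Terms (Σ' : Signature) (V : Set) where
  open Signature Σ'

  data Term : Set where
    var : V → Term
    fun : (f : Sym) → Vec Term (arity f) → Term

  Subst : Set
  Subst = V → Term

  mutual
    _⟨_⟩ : Term → Subst → Term
    var x    ⟨ σ ⟩ = σ x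
    fun f ts ⟨ σ ⟩ = fun f (ts ⟨ σ ⟩*)

    _⟨_⟩* : ∀ {n} → Vec Term n → Subst → Vec Term n
    []       ⟨ σ ⟩* = []
    (t ∷ ts) ⟨ σ ⟩* = (t ⟨ σ ⟩) ∷ (ts ⟨ σ ⟩*)

  data _occursIn_ (x : V) : Term → Set where
    here  : x occursIn var x
    there : ∀ {f ts} (i : Fin (arity f)) → x occursIn lookup ts i → x occursIn fun f ts

  IsVar : Term → Set
  IsVar t = ∃ λ x → t ≡ var x

  record TRS : Set₁ where
    field
      Rule     : Term → Term → Set
      lhs-nonvar : ∀ {l r} → Rule l r → ¬ IsVar l
      var-cond   : ∀ {l r} → Rule l r → ∀ x → x occursIn r → x occursIn l
  open TRS public

  _∪_ : TRS → TRS → TRS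
  Rule (R₁ ∪ R₂) l r = Rule R₁ l r ⊎ Rule R₂ l r
  lhs-nonvar (R₁ ∪ R₂) (Data.Sum.inj₁ p) = lhs-nonvar R₁ p
  lhs-nonvar (R₁ ∪ R₂) (Data.Sum.inj₂ p) = lhs-nonvar R₂ p
  var-cond (R₁ ∪ R₂) (Data.Sum.inj₁ p) = var-cond R₁ p
  var-cond (R₁ ∪ R₂) (Data.Sum.inj₂ p) = var-cond R₂ p

  Rel : Set₁
  Rel = Term → Term → Set

  data _⊢_⟶_ (R : TRS) : Rel where
    root : ∀ {l r} → Rule R l r → (σ : Subst) → R ⊢ (l ⟨ σ ⟩) ⟶ (r ⟨ σ ⟩)
    arg  : ∀ {f ts u} (i : Fin (arity f)) → R ⊢ lookup ts i ⟶ u →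
           R ⊢ fun f ts ⟶ fun f (ts [ i ]≔ u)

  _/_⊢_⟶_ : TRS → TRS → Rel
  R / S ⊢ s ⟶ t = ∃ λ s' → ∃ λ t' →
    Star (S ⊢_⟶_) s s' × (R ⊢ s' ⟶ t') × Star (S ⊢_⟶_) t' t

  data Iter (_⇒_ : Rel) : ℕ → Rel where
    done : ∀ {t} → Iter _⇒_ zero t t
    step : ∀ {m s t u} → s ⇒ t → Iter _⇒_ m t u → Iter _⇒_ (suc m) s u

  Terminating : Rel → Term → Set
  Terminating _⇒_ t =
    ¬ (Σ (ℕ → Term) λ f → (f zero ≡ t) × (∀ i → f i ⇒ f (suc i)))

  -- "dl(t,⇒) ≥ m" :  some ⇒-derivation from t has length m.
  DerivOfLength : Rel → Term → ℕ → Set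
  DerivOfLength _⇒_ t m = ∃ λ u → Iter _⇒_ m t u

  -- dl(t,⇒₁) + dl(t,⇒₂) ≥ dl(t,⇒) in ℕ ∪ {ω}, with dl = sup of derivation
  -- lengths: every length m achieved by ⇒ is bounded by a + b for lengths
  -- a, b achieved by ⇒₁, ⇒₂ respectively.
  DlSumGeq : Rel → Rel → Rel → Term → Set
  DlSumGeq _⇒₁_ _⇒₂_ _⇒_ t = ∀ m → DerivOfLength _⇒_ t m →
    ∃ λ a → ∃ λ b → DerivOfLength _⇒₁_ t a × DerivOfLength _⇒₂_ t b × m ≤ a + b

-- Every step of  →_{(R₁∪R₂)/S}  uses exactly one main rule, from R₁ or from
-- R₂.  A step with an R₁-rule is a step of  →_{R₁/(R₂∪S)}  and, at the same
-- time, a mere  →*_{R₁∪S}  sequence, which the relation  →_{R₂/(R₁∪S)}  can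
-- absorb into the leading  →*_{R₁∪S}  part of its next step; symmetrically
-- for an R₂-rule.
module Submission where

open import Defs
open import Function using (id)
open import Data.Nat using (suc; _+_; _≤_; z≤n; s≤s)
open import Data.Nat.Properties using (+-suc)
open import Data.Product using (_×_; _,_; ∃)
open import Data.Sum using (_⊎_; inj₁; inj₂)
open import Relation.Binary.PropositionalEquality using (subst; sym)
open import Relation.Binary.Construct.Closure.ReflexiveTransitive using (Star; _◅_; _◅◅_; gmap)

module Splitting (Σ' : Signature) (V : Set) where
  open Terms Σ' V

  _⊑_ : TRS → TRS → Set
  R ⊑ R' = ∀ {l r} → Rule R l r → Rule R' l r

  ⊑-∪ˡ : ∀ {R₁ R₂ : TRS} → R₁ ⊑ (R₁ ∪ R₂)
  ⊑-∪ˡ = inj₁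

  ⊑-∪ʳ : ∀ {R₁ R₂ : TRS} → R₂ ⊑ (R₁ ∪ R₂)
  ⊑-∪ʳ = inj₂

  ⟶-mono : ∀ {R R' : TRS} → R ⊑ R' → ∀ {s t} → R ⊢ s ⟶ t → R' ⊢ s ⟶ t
  ⟶-mono R⊑R' (root ρ σ) = root (R⊑R' ρ) σ
  ⟶-mono R⊑R' (arg i p)  = arg i (⟶-mono R⊑R' p)

  ⟶*-mono : ∀ {R R' : TRS} → R ⊑ R' → ∀ {s t} →
            Star (R ⊢_⟶_) s t → Star (R' ⊢_⟶_) s t
  ⟶*-mono R⊑R' = gmap id (⟶-mono R⊑R')

  /-mono : ∀ {R R' S S' : TRS} → R ⊑ R' → S ⊑ S' → ∀ {s t} →
           R / S ⊢ s ⟶ t → R' / S' ⊢ s ⟶ t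
  /-mono R⊑R' S⊑S' (s' , t' , pre , main , post) =
    s' , t' , ⟶*-mono S⊑S' pre , ⟶-mono R⊑R' main , ⟶*-mono S⊑S' post

  /-absorb : ∀ {R S T : TRS} → R ⊑ T → S ⊑ T → ∀ {s t} →
             R / S ⊢ s ⟶ t → Star (T ⊢_⟶_) s t
  /-absorb R⊑T S⊑T (_ , _ , pre , main , post) =
    ⟶*-mono S⊑T pre ◅◅ (⟶-mono R⊑T main ◅ ⟶*-mono S⊑T post)

  /-credit : ∀ {R R' S : TRS} {s t} → R / S ⊢ s ⟶ t →
             (R / (R' ∪ S) ⊢ s ⟶ t) × Star ((R ∪ S) ⊢_⟶_) s t
  /-credit {R} {R'} {S} st =
    /-mono id (⊑-∪ʳ {R'} {S}) st , /-absorb (⊑-∪ˡ {R} {S}) (⊑-∪ʳ {R} {S}) st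

  ∪-split : ∀ {R₁ R₂ : TRS} {s t} →
            (R₁ ∪ R₂) ⊢ s ⟶ t → (R₁ ⊢ s ⟶ t) ⊎ (R₂ ⊢ s ⟶ t)
  ∪-split (root (inj₁ ρ) σ) = inj₁ (root ρ σ)
  ∪-split (root (inj₂ ρ) σ) = inj₂ (root ρ σ)
  ∪-split (arg i p) with ∪-split p
  ... | inj₁ q = inj₁ (arg i q)
  ... | inj₂ q = inj₂ (arg i q)

  /-∪-split : ∀ {R₁ R₂ S : TRS} {s t} →
              (R₁ ∪ R₂) / S ⊢ s ⟶ t → (R₁ / S ⊢ s ⟶ t) ⊎ (R₂ / S ⊢ s ⟶ t)
  /-∪-split (s' , t' , pre , main , post) with ∪-split main
  ... | inj₁ q = inj₁ (s' , t' , pre , q , post)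
  ... | inj₂ q = inj₂ (s' , t' , pre , q , post)

  deriv-prepend : ∀ {R T : TRS} {a s s'} → Star (T ⊢_⟶_) s s' →
                  DerivOfLength (R / T ⊢_⟶_) s' a → DerivOfLength (R / T ⊢_⟶_) s a
  deriv-prepend pre (_ , done) = _ , done
  deriv-prepend pre (_ , step (s₁ , t₁ , pre₁ , main , post) rest) =
    _ , step (s₁ , t₁ , pre ◅◅ pre₁ , main , post) rest

  deriv-cons : ∀ {_⇒_ : Rel} {a s s'} → s ⇒ s' →
               DerivOfLength _⇒_ s' a → DerivOfLength _⇒_ s (suc a)
  deriv-cons st (u , d) = u , step st d

  split-derivation : ∀ {R₁ R₂ S : TRS} {m s u} →
    Iter ((R₁ ∪ R₂) / S ⊢_⟶_) m s u →
    ∃ λ a → ∃ λ b → DerivOfLength (R₁ / (R₂ ∪ S) ⊢_⟶_) s a ×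
      DerivOfLength (R₂ / (R₁ ∪ S) ⊢_⟶_) s b × m ≤ a + b
  split-derivation {s = s} done = 0 , 0 , (s , done) , (s , done) , z≤n
  split-derivation {R₁} {R₂} {m = suc m} (step st rest)
    with /-∪-split st | split-derivation rest
  ... | inj₁ st₁ | a , b , d₁ , d₂ , m≤a+b =
    let (main₁ , absorbed₁) = /-credit {R₁} {R₂} st₁ in
    suc a , b , deriv-cons main₁ d₁ , deriv-prepend absorbed₁ d₂ , s≤s m≤a+b
  ... | inj₂ st₂ | a , b , d₁ , d₂ , m≤a+b =
    let (main₂ , absorbed₂) = /-credit {R₂} {R₁} st₂ in
    a , suc b , deriv-prepend absorbed₂ d₁ , deriv-cons main₂ d₂ ,
    subst (suc m ≤_) (sym (+-suc a b)) (s≤s m≤a+b)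

lemma3p4 : (Σ' : Signature) (V : Set) →
    let open Terms Σ' V in
    (R₁ R₂ S : TRS) (t : Term) →
    Terminating ((R₁ ∪ R₂) / S ⊢_⟶_) t →
    DlSumGeq (R₁ / (R₂ ∪ S) ⊢_⟶_) (R₂ / (R₁ ∪ S) ⊢_⟶_) ((R₁ ∪ R₂) / S ⊢_⟶_) t
lemma3p4 Σ' V R₁ R₂ S t _ m (_ , derivation) =
  Splitting.split-derivation Σ' V derivation
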